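{- Let $\mathbf{G}$ be any one of the sequent calculi $\mathbf{G3}_{\mathsf N}$, $\mathbf{G3}_{\mathsf{NeF}}$, $\mathbf{G3}_{\mathsf{CoPC}}$, $\mathbf{G3}_{\mathsf{MPC}}$. Let $\Gamma,\Delta$ be finite multisets of formulas and $\varphi$ a formula such that the common language of $\Gamma$ and $\Delta,\varphi$ is not empty. If $\Gamma,\Delta\Rightarrow\varphi$ is derivable in $\mathbf{G}$, then there exists a formula $\sigma$ such that (1) every propositional variable occurring in $\sigma$ belongs to the common language of $\Gamma$ and $\Delta,\varphi$, and (2) both $\Gamma\Rightarrow\sigma$ and $\Delta,\sigma\Rightarrow\varphi$ are derivable in $\mathbf{G}$.
   Context: Formulas are built from a countable set of propositional variables $p,q,\dots$ and the constant $\top$ (there is no $\bot$) using binary $\land,\lor,\to$ and unary $\neg$. The common language of two multisets of formulas is the set of propositional variables occurring both in some formula of the first and in some formula of the second. A sequent is $\Gamma\Rightarrow\varphi$ with $\Gamma$ a finite multiset of formulas and $\varphi$ a single formula; $\Gamma,\Delta$ denotes multiset union. The positive rules are: (ax) $\Gamma,p\Rightarrow p$ for a propositional variable $p$; ($\top$) $\Gamma\Rightarrow\top$; ($\to$r) from $\Gamma,\alpha\Rightarrow\beta$ infer $\Gamma\Rightarrow\alpha\to\beta$; ($\to$l) from $\Gamma,\alpha\to\beta\Rightarrow\alpha$ and $\Gamma,\beta\Rightarrow\varphi$ infer $\Gamma,\alpha\to\beta\Rightarrow\varphi$; ($\land$r) from $\Gamma\Rightarrow\alpha$ and $\Gamma\Rightarrow\beta$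 infer $\Gamma\Rightarrow\alpha\land\beta$; ($\land$l) from $\Gamma,\alpha,\beta\Rightarrow\varphi$ infer $\Gamma,\alpha\land\beta\Rightarrow\varphi$; ($\lor$r$_1$), ($\lor$r$_2$) from $\Gamma\Rightarrow\alpha$ (resp. $\Gamma\Rightarrow\beta$) infer $\Gamma\Rightarrow\alpha\lor\beta$; ($\lor$l) from $\Gamma,\alpha\Rightarrow\varphi$ and $\Gamma,\beta\Rightarrow\varphi$ infer $\Gamma,\alpha\lor\beta\Rightarrow\varphi$. The negation rules are: (n) from $\Gamma,\neg\alpha,\beta\Rightarrow\alpha$ and $\Gamma,\neg\alpha,\alpha\Rightarrow\beta$ infer $\Gamma,\neg\alpha\Rightarrow\neg\beta$; (nef) from $\Gamma,\neg\alpha\Rightarrow\alpha$ infer $\Gamma,\neg\alpha\Rightarrow\neg\beta$; (copc) from $\Gamma,\neg\alpha,\beta\Rightarrow\alpha$ infer $\Gamma,\neg\alpha\Rightarrow\neg\beta$; (an) from $\Gamma,\alpha\Rightarrow\neg\alpha$ infer $\Gamma\Rightarrow\neg\alpha$. The calculi (without any structural rules) are: $\mathbf{G3}_{\mathsf N}$ = positive rules + (n); $\mathbf{G3}_{\mathsf{NeF}}$ = positive rules + (n) + (nef); $\mathbf{G3}_{\mathsf{CoPC}}$ = positive rules + (copc); $\mathbf{G3}_{\mathsf{MPC}}$ = positive rules + (copc) + (an). -}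

module Defs where

open import Data.Nat using (ℕ)
open import Data.List using (List; []; _∷_; _++_)
open import Data.List.Relation.Unary.Any using (Any)
open import Data.List.Relation.Binary.Permutation.Propositional using (_↭_)
open import Data.Product using (∃; _×_)

data Formula : Set where
  var  : ℕ → Formula
  ⊤'   : Formula
  _∧'_ : Formula → Formula → Formula
  _∨'_ : Formula → Formula → Formula
  _⇒'_ : Formula → Formula → Formula
  ¬'_  : Formula → Formula

data Occurs (p : ℕ) : Formula → Set where
  o-var : Occurs p (var p)
  o-∧l  : ∀ {a b} → Occurs p a → Occurs p (a ∧' b)
  o-∧r  : ∀ {a b} → Occurs p b → Occurs p (a ∧' b)
  o-∨l  : ∀ {a b} → Occurs p a → Occurs p (a ∨' b)
  o-∨r  : ∀ {a b} → Occurs p b → Occurs p (a ∨' b)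
  o-⇒l  : ∀ {a b} → Occurs p a → Occurs p (a ⇒' b)
  o-⇒r  : ∀ {a b} → Occurs p b → Occurs p (a ⇒' b)
  o-¬   : ∀ {a} → Occurs p a → Occurs p (¬' a)

-- Finite multisets of formulas are represented as lists; list order is irrelevant
-- because every rule matches its principal/side formulas up to permutation (_↭_).
Ctx : Set
Ctx = List Formula

OccursIn : ℕ → Ctx → Set
OccursIn p Γ = Any (Occurs p) Γ

InCommon : ℕ → Ctx → Ctx → Set
InCommon p Γ Δ = OccursIn p Γ × OccursIn p Δ

data Calculus : Set where
  N NeF CoPC MPC : Calculus

data HasN : Calculus → Set where
  n-N   : HasN N
  n-NeF : HasN NeF

data HasNeF : Calculus → Set where
  nef-NeF : HasNeF NeF

data HasCoPC : Calculus → Set where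
  copc-CoPC : HasCoPC CoPC
  copc-MPC  : HasCoPC MPC

data HasAn : Calculus → Set where
  an-MPC : HasAn MPC

-- Derivability of Γ ⇒ φ in calculus G (no structural rules).
-- A conclusion context "Γ , α" is any list Γ' with Γ' ↭ α ∷ Γ.
infix 4 _⊢_⇒_
data _⊢_⇒_ (G : Calculus) : Ctx → Formula → Set where
  ax   : ∀ {Γ Γ' p} → Γ' ↭ var p ∷ Γ → G ⊢ Γ' ⇒ var p
  top  : ∀ {Γ} → G ⊢ Γ ⇒ ⊤'
  →r   : ∀ {Γ a b} → G ⊢ a ∷ Γ ⇒ b → G ⊢ Γ ⇒ (a ⇒' b)
  →l   : ∀ {Γ Γ' a b φ} → Γ' ↭ (a ⇒' b) ∷ Γ →
         G ⊢ (a ⇒' b) ∷ Γ ⇒ a → G ⊢ b ∷ Γ ⇒ φ → G ⊢ Γ' ⇒ φ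
  ∧r   : ∀ {Γ a b} → G ⊢ Γ ⇒ a → G ⊢ Γ ⇒ b → G ⊢ Γ ⇒ (a ∧' b)
  ∧l   : ∀ {Γ Γ' a b φ} → Γ' ↭ (a ∧' b) ∷ Γ →
         G ⊢ a ∷ b ∷ Γ ⇒ φ → G ⊢ Γ' ⇒ φ
  ∨r₁  : ∀ {Γ a b} → G ⊢ Γ ⇒ a → G ⊢ Γ ⇒ (a ∨' b)
  ∨r₂  : ∀ {Γ a b} → G ⊢ Γ ⇒ b → G ⊢ Γ ⇒ (a ∨' b)
  ∨l   : ∀ {Γ Γ' a b φ} → Γ' ↭ (a ∨' b) ∷ Γ →
         G ⊢ a ∷ Γ ⇒ φ → G ⊢ b ∷ Γ ⇒ φ → G ⊢ Γ' ⇒ φ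
  n    : HasN G → ∀ {Γ Γ' a b} → Γ' ↭ (¬' a) ∷ Γ →
         G ⊢ b ∷ (¬' a) ∷ Γ ⇒ a → G ⊢ a ∷ (¬' a) ∷ Γ ⇒ b → G ⊢ Γ' ⇒ ¬' b
  nef  : HasNeF G → ∀ {Γ Γ' a b} → Γ' ↭ (¬' a) ∷ Γ →
         G ⊢ (¬' a) ∷ Γ ⇒ a → G ⊢ Γ' ⇒ ¬' b
  copc : HasCoPC G → ∀ {Γ Γ' a b} → Γ' ↭ (¬' a) ∷ Γ →
         G ⊢ b ∷ (¬' a) ∷ Γ ⇒ a → G ⊢ Γ' ⇒ ¬' b
  an   : HasAn G → ∀ {Γ a} → G ⊢ a ∷ Γ ⇒ ¬' a → G ⊢ Γ ⇒ ¬' a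

-- Maehara's method: by induction on a derivation of Π ⇒ φ, an interpolant is built for
-- every splitting of Π into Γ, Δ.  When the principal formula of a left rule lies in Γ,
-- a premise whose succedent comes from that rule (the left premise of →l, the premises of
-- the negation rules) is interpolated with the roles of Γ and Δ exchanged, and the
-- interpolants of the premises are combined by →, ∧, ∨ or ¬.  Only (n) with principal
-- formula in Γ needs more: its two premises split the context in opposite ways, and
-- recombining their interpolants uses cut.  Cut is admissible in the calculi with (n), by
-- induction on the cut formula and the heights of the premises, using height-preserving
-- weakening and invertibility of the left rules.
module Submission where

open import Defs
open import Data.Nat using (ℕ; suc; _≤_; s≤s; _⊔_)
open import Data.Nat.Properties using (m≤m⊔n; m≤n⊔m; n≤1+n)
open import Data.List using (List; []; _∷_; _++_; [_])
open import Data.List.Relation.Unary.Any using (here; there)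
open import Data.List.Relation.Binary.Permutation.Propositional
  using (_↭_; prep; swap; ↭-refl; ↭-sym; ↭-trans)
open import Data.List.Relation.Binary.Permutation.Propositional.Properties
  using (shift; shifts; drop-∷; ++⁺ˡ; ++⁺ʳ; ++-comm; ++-assoc; ∈-resp-↭; Any-resp-↭)
open import Data.List.Membership.Propositional using (_∈_)
open import Data.List.Membership.Propositional.Properties using (∈-∃++; ∈-++⁻)
open import Data.Product using (∃; Σ; _×_; _,_)
open import Data.Sum using (_⊎_; inj₁; inj₂)
open import Data.Empty using (⊥-elim)
open import Function using (id; _∘_)
open import Relation.Binary.PropositionalEquality using (_≡_; _≢_; refl)
open import Relation.Nullary using (¬_)

private
  variable
    G : Calculus
    k m p : ℕ
    a b c s t A C φ σ : Formula
    Γ Γ' Γ₀ Δ Δ' Π : Ctx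

-- Permutations

module _ {ℓ} {X : Set ℓ} where

  infixr 5 _⟫_
  _⟫_ : {xs ys zs : List X} → xs ↭ ys → ys ↭ zs → xs ↭ zs
  _⟫_ = ↭-trans

  swap-front : ∀ x y {xs : List X} → x ∷ y ∷ xs ↭ y ∷ x ∷ xs
  swap-front x y = swap x y ↭-refl

  under : ∀ xs {ys zs : List X} {x} → ys ↭ x ∷ zs → xs ++ ys ↭ x ∷ xs ++ zs
  under xs {zs = zs} {x} π = ++⁺ˡ xs π ⟫ shift x xs zs

  cross : ∀ {x y : X} {xs ys zs} → ys ↭ x ∷ zs → xs ↭ y ∷ zs → y ∷ ys ↭ x ∷ xs
  cross {x} {y} ρ₀ ρ = under [ y ] ρ₀ ⟫ prep x (↭-sym ρ)

  extendʳ : ∀ xs {zs ys₁ ys₂ : List X} → zs ↭ ys₁ ++ ys₂ → xs ++ zs ↭ ys₁ ++ xs ++ ys₂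
  extendʳ xs {ys₁ = ys₁} π = ++⁺ˡ xs π ⟫ shifts xs ys₁

  extendˡ-flip : ∀ xs {zs ys₁ ys₂ : List X} → zs ↭ ys₁ ++ ys₂ → xs ++ zs ↭ ys₂ ++ xs ++ ys₁
  extendˡ-flip xs {ys₁ = ys₁} {ys₂} π =
    ++⁺ˡ xs π ⟫ ↭-sym (++-assoc xs ys₁ ys₂) ⟫ ++-comm (xs ++ ys₁) ys₂

  ∈⇒↭∷ : ∀ {x : X} {xs} → x ∈ xs → ∃ λ ys → xs ↭ x ∷ ys
  ∈⇒↭∷ {x} x∈xs with ∈-∃++ x∈xs
  ... | ys , zs , refl = ys ++ zs , shift x ys zs

  ↭-∷-inv : ∀ {x y : X} {xs ys} → x ∷ xs ↭ y ∷ ys →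
            (x ≡ y × xs ↭ ys) ⊎ (∃ λ zs → xs ↭ y ∷ zs × ys ↭ x ∷ zs)
  ↭-∷-inv {x} {y} π with ∈-resp-↭ (↭-sym π) (here refl)
  ... | here refl = inj₁ (refl , drop-∷ π)
  ... | there y∈xs with ∈⇒↭∷ y∈xs
  ...   | zs , ρ = inj₂ (zs , ρ , drop-∷ (↭-sym π ⟫ prep x ρ ⟫ swap-front x y))

  data Split (x : X) (xs ys rest : List X) : Set ℓ where
    inˡ : ∀ {xs⁻} → xs ↭ x ∷ xs⁻ → rest ↭ xs⁻ ++ ys → Split x xs ys rest
    inʳ : ∀ {ys⁻} → ys ↭ x ∷ ys⁻ → rest ↭ xs ++ ys⁻ → Split x xs ys rest

  split : ∀ xs ys {x rest} → xs ++ ys ↭ x ∷ rest → Split x xs ys rest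
  split xs ys π with ∈-++⁻ xs (∈-resp-↭ (↭-sym π) (here refl))
  ... | inj₁ x∈xs with ∈⇒↭∷ x∈xs
  ...   | _ , ρ = inˡ ρ (drop-∷ (↭-sym π ⟫ ++⁺ʳ ys ρ))
  split xs ys π | inj₂ x∈ys with ∈⇒↭∷ x∈ys
  ...   | _ , ρ = inʳ ρ (drop-∷ (↭-sym π ⟫ under xs ρ))

-- Height-bounded derivations

-- k bounds the height: axioms are derivable at every height.
infix 4 _⊢[_]_⇒_
data _⊢[_]_⇒_ (G : Calculus) : ℕ → Ctx → Formula → Set where
  ax   : Γ' ↭ var p ∷ Γ → G ⊢[ k ] Γ' ⇒ var p
  top  : G ⊢[ k ] Γ ⇒ ⊤'
  →r   : G ⊢[ k ] a ∷ Γ ⇒ b → G ⊢[ suc k ] Γ ⇒ (a ⇒' b)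
  →l   : Γ' ↭ (a ⇒' b) ∷ Γ →
         G ⊢[ k ] (a ⇒' b) ∷ Γ ⇒ a → G ⊢[ k ] b ∷ Γ ⇒ φ → G ⊢[ suc k ] Γ' ⇒ φ
  ∧r   : G ⊢[ k ] Γ ⇒ a → G ⊢[ k ] Γ ⇒ b → G ⊢[ suc k ] Γ ⇒ (a ∧' b)
  ∧l   : Γ' ↭ (a ∧' b) ∷ Γ → G ⊢[ k ] a ∷ b ∷ Γ ⇒ φ → G ⊢[ suc k ] Γ' ⇒ φ
  ∨r₁  : G ⊢[ k ] Γ ⇒ a → G ⊢[ suc k ] Γ ⇒ (a ∨' b)
  ∨r₂  : G ⊢[ k ] Γ ⇒ b → G ⊢[ suc k ] Γ ⇒ (a ∨' b)
  ∨l   : Γ' ↭ (a ∨' b) ∷ Γ →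
         G ⊢[ k ] a ∷ Γ ⇒ φ → G ⊢[ k ] b ∷ Γ ⇒ φ → G ⊢[ suc k ] Γ' ⇒ φ
  n    : HasN G → Γ' ↭ (¬' a) ∷ Γ →
         G ⊢[ k ] b ∷ (¬' a) ∷ Γ ⇒ a → G ⊢[ k ] a ∷ (¬' a) ∷ Γ ⇒ b →
         G ⊢[ suc k ] Γ' ⇒ ¬' b
  nef  : HasNeF G → Γ' ↭ (¬' a) ∷ Γ →
         G ⊢[ k ] (¬' a) ∷ Γ ⇒ a → G ⊢[ suc k ] Γ' ⇒ ¬' b
  copc : HasCoPC G → Γ' ↭ (¬' a) ∷ Γ →
         G ⊢[ k ] b ∷ (¬' a) ∷ Γ ⇒ a → G ⊢[ suc k ] Γ' ⇒ ¬' b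
  an   : HasAn G → G ⊢[ k ] a ∷ Γ ⇒ ¬' a → G ⊢[ suc k ] Γ ⇒ ¬' a

height-mono : k ≤ m → G ⊢[ k ] Γ ⇒ φ → G ⊢[ m ] Γ ⇒ φ
height-mono _ (ax q) = ax q
height-mono _ top = top
height-mono (s≤s le) (→r d) = →r (height-mono le d)
height-mono (s≤s le) (→l q d e) = →l q (height-mono le d) (height-mono le e)
height-mono (s≤s le) (∧r d e) = ∧r (height-mono le d) (height-mono le e)
height-mono (s≤s le) (∧l q d) = ∧l q (height-mono le d)
height-mono (s≤s le) (∨r₁ d) = ∨r₁ (height-mono le d)
height-mono (s≤s le) (∨r₂ d) = ∨r₂ (height-mono le d)
height-mono (s≤s le) (∨l q d e) = ∨l q (height-mono le d) (height-mono le e)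
height-mono (s≤s le) (n h q d e) = n h q (height-mono le d) (height-mono le e)
height-mono (s≤s le) (nef h q d) = nef h q (height-mono le d)
height-mono (s≤s le) (copc h q d) = copc h q (height-mono le d)
height-mono (s≤s le) (an h d) = an h (height-mono le d)

height-suc : G ⊢[ k ] Γ ⇒ φ → G ⊢[ suc k ] Γ ⇒ φ
height-suc = height-mono (n≤1+n _)

forget-height : G ⊢[ k ] Γ ⇒ φ → G ⊢ Γ ⇒ φ
forget-height (ax q) = ax q
forget-height top = top
forget-height (→r d) = →r (forget-height d)
forget-height (→l q d e) = →l q (forget-height d) (forget-height e)
forget-height (∧r d e) = ∧r (forget-height d) (forget-height e)
forget-height (∧l q d) = ∧l q (forget-height d)
forget-height (∨r₁ d) = ∨r₁ (forget-height d)
forget-height (∨r₂ d) = ∨r₂ (forget-height d)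
forget-height (∨l q d e) = ∨l q (forget-height d) (forget-height e)
forget-height (n h q d e) = n h q (forget-height d) (forget-height e)
forget-height (nef h q d) = nef h q (forget-height d)
forget-height (copc h q d) = copc h q (forget-height d)
forget-height (an h d) = an h (forget-height d)

height : G ⊢ Γ ⇒ φ → ℕ
height (ax _) = 0
height top = 0
height (→r d) = suc (height d)
height (→l _ d e) = suc (height d ⊔ height e)
height (∧r d e) = suc (height d ⊔ height e)
height (∧l _ d) = suc (height d)
height (∨r₁ d) = suc (height d)
height (∨r₂ d) = suc (height d)
height (∨l _ d e) = suc (height d ⊔ height e)
height (n _ _ d e) = suc (height d ⊔ height e)
height (nef _ _ d) = suc (height d)
height (copc _ _ d) = suc (height d)
height (an _ d) = suc (height d)

with-height : (d : G ⊢ Γ ⇒ φ) → G ⊢[ height d ] Γ ⇒ φ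

⊔-left : (d : G ⊢ Γ ⇒ a) (e : G ⊢ Γ' ⇒ b) → G ⊢[ height d ⊔ height e ] Γ ⇒ a
⊔-left d e = height-mono (m≤m⊔n (height d) (height e)) (with-height d)

⊔-right : (d : G ⊢ Γ ⇒ a) (e : G ⊢ Γ' ⇒ b) → G ⊢[ height d ⊔ height e ] Γ' ⇒ b
⊔-right d e = height-mono (m≤n⊔m (height d) (height e)) (with-height e)

with-height (ax q) = ax q
with-height top = top
with-height (→r d) = →r (with-height d)
with-height (→l q d e) = →l q (⊔-left d e) (⊔-right d e)
with-height (∧r d e) = ∧r (⊔-left d e) (⊔-right d e)
with-height (∧l q d) = ∧l q (with-height d)
with-height (∨r₁ d) = ∨r₁ (with-height d)
with-height (∨r₂ d) = ∨r₂ (with-height d)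
with-height (∨l q d e) = ∨l q (⊔-left d e) (⊔-right d e)
with-height (n h q d e) = n h q (⊔-left d e) (⊔-right d e)
with-height (nef h q d) = nef h q (with-height d)
with-height (copc h q d) = copc h q (with-height d)
with-height (an h d) = an h (with-height d)

exchangeʰ : Γ ↭ Γ' → G ⊢[ k ] Γ ⇒ φ → G ⊢[ k ] Γ' ⇒ φ
exchangeʰ π (ax q) = ax (↭-sym π ⟫ q)
exchangeʰ π top = top
exchangeʰ π (→r {a = a} d) = →r (exchangeʰ (prep a π) d)
exchangeʰ π (→l q d e) = →l (↭-sym π ⟫ q) d e
exchangeʰ π (∧r d e) = ∧r (exchangeʰ π d) (exchangeʰ π e)
exchangeʰ π (∧l q d) = ∧l (↭-sym π ⟫ q) d
exchangeʰ π (∨r₁ d) = ∨r₁ (exchangeʰ π d)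
exchangeʰ π (∨r₂ d) = ∨r₂ (exchangeʰ π d)
exchangeʰ π (∨l q d e) = ∨l (↭-sym π ⟫ q) d e
exchangeʰ π (n h q d e) = n h (↭-sym π ⟫ q) d e
exchangeʰ π (nef h q d) = nef h (↭-sym π ⟫ q) d
exchangeʰ π (copc h q d) = copc h (↭-sym π ⟫ q) d
exchangeʰ π (an {a = a} h d) = an h (exchangeʰ (prep a π) d)

weakenʰ : ∀ c → G ⊢[ k ] Γ ⇒ φ → G ⊢[ k ] c ∷ Γ ⇒ φ
weaken-premiseʰ : ∀ xs c → G ⊢[ k ] xs ++ Γ ⇒ φ → G ⊢[ k ] xs ++ c ∷ Γ ⇒ φ

weakenʰ c (ax q) = ax (under [ c ] q)
weakenʰ c top = top
weakenʰ c (→r {a = a} d) = →r (weaken-premiseʰ [ a ] c d)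
weakenʰ c (→l {a = a} {b} q d e) =
  →l (under [ c ] q) (weaken-premiseʰ [ a ⇒' b ] c d) (weaken-premiseʰ [ b ] c e)
weakenʰ c (∧r d e) = ∧r (weakenʰ c d) (weakenʰ c e)
weakenʰ c (∧l {a = a} {b} q d) = ∧l (under [ c ] q) (weaken-premiseʰ (a ∷ b ∷ []) c d)
weakenʰ c (∨r₁ d) = ∨r₁ (weakenʰ c d)
weakenʰ c (∨r₂ d) = ∨r₂ (weakenʰ c d)
weakenʰ c (∨l {a = a} {b} q d e) =
  ∨l (under [ c ] q) (weaken-premiseʰ [ a ] c d) (weaken-premiseʰ [ b ] c e)
weakenʰ c (n {a = a} {b = b} h q d e) =
  n h (under [ c ] q) (weaken-premiseʰ (b ∷ ¬' a ∷ []) c d)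
                      (weaken-premiseʰ (a ∷ ¬' a ∷ []) c e)
weakenʰ c (nef {a = a} h q d) = nef h (under [ c ] q) (weaken-premiseʰ [ ¬' a ] c d)
weakenʰ c (copc {a = a} {b = b} h q d) =
  copc h (under [ c ] q) (weaken-premiseʰ (b ∷ ¬' a ∷ []) c d)
weakenʰ c (an {a = a} h d) = an h (weaken-premiseʰ [ a ] c d)

weaken-premiseʰ xs c d = exchangeʰ (shifts [ c ] xs) (weakenʰ c d)

record LeftInvertible (G : Calculus) (P : Formula) (Qs : Ctx) : Set where
  field
    not-atom     : P ≢ var p
    not-negation : P ≢ ¬' a
    at-→l : P ≡ (a ⇒' b) → G ⊢[ k ] (a ⇒' b) ∷ Γ ⇒ a → G ⊢[ k ] b ∷ Γ ⇒ φ →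
            G ⊢[ suc k ] Qs ++ Γ ⇒ φ
    at-∧l : P ≡ (a ∧' b) → G ⊢[ k ] a ∷ b ∷ Γ ⇒ φ → G ⊢[ suc k ] Qs ++ Γ ⇒ φ
    at-∨l : P ≡ (a ∨' b) → G ⊢[ k ] a ∷ Γ ⇒ φ → G ⊢[ k ] b ∷ Γ ⇒ φ →
            G ⊢[ suc k ] Qs ++ Γ ⇒ φ

module _ {P Qs} (inv : LeftInvertible G P Qs) where
  open LeftInvertible inv

  invertʰ : G ⊢[ k ] Γ' ⇒ φ → Γ' ↭ P ∷ Γ → G ⊢[ k ] Qs ++ Γ ⇒ φ
  invert-premiseʰ : ∀ xs → G ⊢[ k ] xs ++ Γ' ⇒ φ → Γ' ↭ P ∷ Γ →
                    G ⊢[ k ] xs ++ Qs ++ Γ ⇒ φ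

  invertʰ (ax q) π with ↭-∷-inv (↭-sym π ⟫ q)
  ... | inj₁ (eq , _) = ⊥-elim (not-atom eq)
  ... | inj₂ (_ , ρ , _) = ax (under Qs ρ)
  invertʰ top π = top
  invertʰ (→r {a = a} d) π = →r (invert-premiseʰ [ a ] d π)
  invertʰ (∧r d e) π = ∧r (invertʰ d π) (invertʰ e π)
  invertʰ (∨r₁ d) π = ∨r₁ (invertʰ d π)
  invertʰ (∨r₂ d) π = ∨r₂ (invertʰ d π)
  invertʰ (an {a = a} h d) π = an h (invert-premiseʰ [ a ] d π)
  invertʰ (→l {a = a} {b} q d e) π with ↭-∷-inv (↭-sym π ⟫ q)
  ... | inj₁ (eq , ρ) =
    at-→l eq (exchangeʰ (prep _ (↭-sym ρ)) d) (exchangeʰ (prep b (↭-sym ρ)) e)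
  ... | inj₂ (_ , ρ , ρ₀) =
    →l (under Qs ρ) (invert-premiseʰ [ a ⇒' b ] d ρ₀) (invert-premiseʰ [ b ] e ρ₀)
  invertʰ (∧l {a = a} {b} q d) π with ↭-∷-inv (↭-sym π ⟫ q)
  ... | inj₁ (eq , ρ) = at-∧l eq (exchangeʰ (prep a (prep b (↭-sym ρ))) d)
  ... | inj₂ (_ , ρ , ρ₀) = ∧l (under Qs ρ) (invert-premiseʰ (a ∷ b ∷ []) d ρ₀)
  invertʰ (∨l {a = a} {b} q d e) π with ↭-∷-inv (↭-sym π ⟫ q)
  ... | inj₁ (eq , ρ) =
    at-∨l eq (exchangeʰ (prep a (↭-sym ρ)) d) (exchangeʰ (prep b (↭-sym ρ)) e)
  ... | inj₂ (_ , ρ , ρ₀) =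
    ∨l (under Qs ρ) (invert-premiseʰ [ a ] d ρ₀) (invert-premiseʰ [ b ] e ρ₀)
  invertʰ (n {a = a} {b = b} h q d e) π with ↭-∷-inv (↭-sym π ⟫ q)
  ... | inj₁ (eq , _) = ⊥-elim (not-negation eq)
  ... | inj₂ (_ , ρ , ρ₀) =
    n h (under Qs ρ) (invert-premiseʰ (b ∷ ¬' a ∷ []) d ρ₀)
                     (invert-premiseʰ (a ∷ ¬' a ∷ []) e ρ₀)
  invertʰ (nef {a = a} h q d) π with ↭-∷-inv (↭-sym π ⟫ q)
  ... | inj₁ (eq , _) = ⊥-elim (not-negation eq)
  ... | inj₂ (_ , ρ , ρ₀) = nef h (under Qs ρ) (invert-premiseʰ [ ¬' a ] d ρ₀)
  invertʰ (copc {a = a} {b = b} h q d) π with ↭-∷-inv (↭-sym π ⟫ q)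
  ... | inj₁ (eq , _) = ⊥-elim (not-negation eq)
  ... | inj₂ (_ , ρ , ρ₀) = copc h (under Qs ρ) (invert-premiseʰ (b ∷ ¬' a ∷ []) d ρ₀)

  invert-premiseʰ xs d π = exchangeʰ (shifts Qs xs) (invertʰ d (under xs π))

∧l-invʰ : G ⊢[ k ] Γ' ⇒ φ → Γ' ↭ (a ∧' b) ∷ Γ → G ⊢[ k ] a ∷ b ∷ Γ ⇒ φ
∧l-invʰ = invertʰ record
  { not-atom = λ () ; not-negation = λ () ; at-→l = λ () ; at-∨l = λ ()
  ; at-∧l = λ { refl d → height-suc d } }

∨l-invˡʰ : G ⊢[ k ] Γ' ⇒ φ → Γ' ↭ (a ∨' b) ∷ Γ → G ⊢[ k ] a ∷ Γ ⇒ φ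
∨l-invˡʰ = invertʰ record
  { not-atom = λ () ; not-negation = λ () ; at-→l = λ () ; at-∧l = λ ()
  ; at-∨l = λ { refl d _ → height-suc d } }

∨l-invʳʰ : G ⊢[ k ] Γ' ⇒ φ → Γ' ↭ (a ∨' b) ∷ Γ → G ⊢[ k ] b ∷ Γ ⇒ φ
∨l-invʳʰ = invertʰ record
  { not-atom = λ () ; not-negation = λ () ; at-→l = λ () ; at-∧l = λ ()
  ; at-∨l = λ { refl _ e → height-suc e } }

→l-invʳʰ : G ⊢[ k ] Γ' ⇒ φ → Γ' ↭ (a ⇒' b) ∷ Γ → G ⊢[ k ] b ∷ Γ ⇒ φ
→l-invʳʰ = invertʰ record
  { not-atom = λ () ; not-negation = λ () ; at-∨l = λ () ; at-∧l = λ ()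
  ; at-→l = λ { refl _ e → height-suc e } }

exchange : Γ ↭ Γ' → G ⊢ Γ ⇒ φ → G ⊢ Γ' ⇒ φ
exchange π d = forget-height (exchangeʰ π (with-height d))

weaken : ∀ c → G ⊢ Γ ⇒ φ → G ⊢ c ∷ Γ ⇒ φ
weaken c d = forget-height (weakenʰ c (with-height d))

weaken-premise : ∀ xs c → G ⊢ xs ++ Γ ⇒ φ → G ⊢ xs ++ c ∷ Γ ⇒ φ
weaken-premise xs c d = exchange (shifts [ c ] xs) (weaken c d)

-- Cut admissibility

HasN⇒¬HasCoPC : HasN G → ¬ HasCoPC G
HasN⇒¬HasCoPC n-N ()
HasN⇒¬HasCoPC n-NeF ()

HasN⇒¬HasAn : HasN G → ¬ HasAn G
HasN⇒¬HasAn n-N ()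
HasN⇒¬HasAn n-NeF ()

module CutAdmissibility (hasN : HasN G) where

  -- (n) and (nef) count as right rules: they introduce a negation in the succedent.
  data RightRule : G ⊢[ k ] Γ ⇒ A → Set where
    r-ax  : {q : Γ' ↭ var p ∷ Γ} → RightRule (ax {k = k} q)
    r-top : RightRule (top {k = k} {Γ = Γ})
    r-→r  : {d : G ⊢[ k ] a ∷ Γ ⇒ b} → RightRule (→r d)
    r-∧r  : {d : G ⊢[ k ] Γ ⇒ a} {e : G ⊢[ k ] Γ ⇒ b} → RightRule (∧r d e)
    r-∨r₁ : {d : G ⊢[ k ] Γ ⇒ a} → RightRule (∨r₁ {b = b} d)
    r-∨r₂ : {d : G ⊢[ k ] Γ ⇒ b} → RightRule (∨r₂ {a = a} d)
    r-n   : ∀ {k Γ Γ' a b} {h : HasN G} {q : Γ' ↭ (¬' a) ∷ Γ}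
            {d : G ⊢[ k ] b ∷ (¬' a) ∷ Γ ⇒ a} {e : G ⊢[ k ] a ∷ (¬' a) ∷ Γ ⇒ b} →
            RightRule (n h q d e)
    r-nef : ∀ {k Γ Γ' a b} {h : HasNeF G} {q : Γ' ↭ (¬' a) ∷ Γ}
            {d : G ⊢[ k ] (¬' a) ∷ Γ ⇒ a} → RightRule (nef {b = b} h q d)

  -- Recursion on the cut formula A, then on k, then on m.  The principal reductions
  -- receive the cuts of A against the side premises already performed, so that they only
  -- cut proper subformulas of A.
  cutʰ : ∀ k m → G ⊢[ k ] Γ ⇒ A → G ⊢[ m ] Γ' ⇒ C → Γ' ↭ A ∷ Γ → G ⊢ Γ ⇒ C
  cut-rightʰ : ∀ k m (d : G ⊢[ k ] Γ ⇒ A) → RightRule d →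
               G ⊢[ m ] Γ' ⇒ C → Γ' ↭ A ∷ Γ → G ⊢ Γ ⇒ C
  reduce-⇒ : ∀ k m (d : G ⊢[ k ] Γ ⇒ (a ⇒' b)) → RightRule d →
             G ⊢ Γ ⇒ a → G ⊢[ m ] b ∷ Γ ⇒ C → G ⊢ Γ ⇒ C
  reduce-∧ : ∀ k m (d : G ⊢[ k ] Γ ⇒ (a ∧' b)) → RightRule d →
             G ⊢[ m ] a ∷ b ∷ Γ ⇒ C → G ⊢ Γ ⇒ C
  reduce-∨ : ∀ k m (d : G ⊢[ k ] Γ ⇒ (a ∨' b)) → RightRule d →
             G ⊢[ m ] a ∷ Γ ⇒ C → G ⊢[ m ] b ∷ Γ ⇒ C → G ⊢ Γ ⇒ C
  reduce-n : ∀ k (d : G ⊢[ k ] Γ ⇒ ¬' a) → RightRule d →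
             G ⊢ b ∷ Γ ⇒ a → G ⊢ a ∷ Γ ⇒ b → G ⊢ Γ ⇒ ¬' b
  reduce-nef : ∀ k → HasNeF G → (d : G ⊢[ k ] Γ ⇒ ¬' a) → RightRule d →
               G ⊢ Γ ⇒ a → G ⊢ Γ ⇒ ¬' b

  cutʰ {A = A} (suc k) m (→l {b = b} q d e) d′ π =
    →l q (forget-height d)
         (cutʰ k m e (→l-invʳʰ d′ (π ⟫ under [ A ] q)) (under [ b ] ↭-refl))
  cutʰ {A = A} (suc k) m (∧l {a = a} {b} q e) d′ π =
    ∧l q (cutʰ k m e (∧l-invʰ d′ (π ⟫ under [ A ] q)) (under (a ∷ b ∷ []) ↭-refl))
  cutʰ {A = A} (suc k) m (∨l {a = a} {b} q e₁ e₂) d′ π =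
    ∨l q (cutʰ k m e₁ (∨l-invˡʰ d′ (π ⟫ under [ A ] q)) (under [ a ] ↭-refl))
         (cutʰ k m e₂ (∨l-invʳʰ d′ (π ⟫ under [ A ] q)) (under [ b ] ↭-refl))
  cutʰ _ _ (copc h _ _) _ _ = ⊥-elim (HasN⇒¬HasCoPC hasN h)
  cutʰ _ _ (an h _) _ _ = ⊥-elim (HasN⇒¬HasAn hasN h)
  cutʰ k m d@(ax _) = cut-rightʰ k m d r-ax
  cutʰ k m d@top = cut-rightʰ k m d r-top
  cutʰ k m d@(→r _) = cut-rightʰ k m d r-→r
  cutʰ k m d@(∧r _ _) = cut-rightʰ k m d r-∧r
  cutʰ k m d@(∨r₁ _) = cut-rightʰ k m d r-∨r₁
  cutʰ k m d@(∨r₂ _) = cut-rightʰ k m d r-∨r₂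
  cutʰ k m d@(n _ _ _ _) = cut-rightʰ k m d r-n
  cutʰ k m d@(nef _ _ _) = cut-rightʰ k m d r-nef

  cut-rightʰ k m d r (ax q) π with ↭-∷-inv (↭-sym π ⟫ q)
  ... | inj₁ (refl , _) = forget-height d
  ... | inj₂ (_ , ρ , _) = ax ρ
  cut-rightʰ k m d r top π = top
  cut-rightʰ k (suc m) d r (→r {a = a} e) π = →r (cutʰ k m (weakenʰ a d) e (under [ a ] π))
  cut-rightʰ k (suc m) d r (∧r e₁ e₂) π = ∧r (cutʰ k m d e₁ π) (cutʰ k m d e₂ π)
  cut-rightʰ k (suc m) d r (∨r₁ e) π = ∨r₁ (cutʰ k m d e π)
  cut-rightʰ k (suc m) d r (∨r₂ e) π = ∨r₂ (cutʰ k m d e π)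
  cut-rightʰ _ _ _ _ (copc h _ _) _ = ⊥-elim (HasN⇒¬HasCoPC hasN h)
  cut-rightʰ _ _ _ _ (an h _) _ = ⊥-elim (HasN⇒¬HasAn hasN h)
  cut-rightʰ k (suc m) d r (→l {a = a} {b} q e₁ e₂) π with ↭-∷-inv (↭-sym π ⟫ q)
  ... | inj₁ (refl , ρ) =
    reduce-⇒ k m d r (cutʰ k m d e₁ (prep _ (↭-sym ρ))) (exchangeʰ (prep b (↭-sym ρ)) e₂)
  ... | inj₂ (_ , ρ , ρ₀) =
    →l ρ (exchange ρ (cutʰ k m d e₁ (cross ρ₀ ρ)))
         (cutʰ k m (→l-invʳʰ d ρ) e₂ (under [ b ] ρ₀))
  cut-rightʰ k (suc m) d r (∧l {a = a} {b} q e) π with ↭-∷-inv (↭-sym π ⟫ q)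
  ... | inj₁ (refl , ρ) = reduce-∧ k m d r (exchangeʰ (prep a (prep b (↭-sym ρ))) e)
  ... | inj₂ (_ , ρ , ρ₀) = ∧l ρ (cutʰ k m (∧l-invʰ d ρ) e (under (a ∷ b ∷ []) ρ₀))
  cut-rightʰ k (suc m) d r (∨l {a = a} {b} q e₁ e₂) π with ↭-∷-inv (↭-sym π ⟫ q)
  ... | inj₁ (refl , ρ) =
    reduce-∨ k m d r (exchangeʰ (prep a (↭-sym ρ)) e₁) (exchangeʰ (prep b (↭-sym ρ)) e₂)
  ... | inj₂ (_ , ρ , ρ₀) =
    ∨l ρ (cutʰ k m (∨l-invˡʰ d ρ) e₁ (under [ a ] ρ₀))
         (cutʰ k m (∨l-invʳʰ d ρ) e₂ (under [ b ] ρ₀))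
  cut-rightʰ k (suc m) d r (n {a = a} {b = b} h q e₁ e₂) π with ↭-∷-inv (↭-sym π ⟫ q)
  ... | inj₁ (refl , ρ) =
    reduce-n k d r (cutʰ k m (weakenʰ b d) e₁ (under [ b ] (prep _ (↭-sym ρ))))
                   (cutʰ k m (weakenʰ a d) e₂ (under [ a ] (prep _ (↭-sym ρ))))
  ... | inj₂ (_ , ρ , ρ₀) =
    n h ρ (exchange (prep b ρ) (cutʰ k m (weakenʰ b d) e₁ (under [ b ] (cross ρ₀ ρ))))
          (exchange (prep a ρ) (cutʰ k m (weakenʰ a d) e₂ (under [ a ] (cross ρ₀ ρ))))
  cut-rightʰ k (suc m) d r (nef h q e) π with ↭-∷-inv (↭-sym π ⟫ q)
  ... | inj₁ (refl , ρ) = reduce-nef k h d r (cutʰ k m d e (prep _ (↭-sym ρ)))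
  ... | inj₂ (_ , ρ , ρ₀) = nef h ρ (exchange ρ (cutʰ k m d e (cross ρ₀ ρ)))

  reduce-⇒ (suc k) m (→r f) r-→r ⊢a e =
    let ⊢b = cutʰ (height ⊢a) k (with-height ⊢a) f ↭-refl
    in  cutʰ (height ⊢b) m (with-height ⊢b) e ↭-refl

  reduce-∧ (suc k) m (∧r f g) r-∧r e =
    let a⊢C = cutʰ k m (weakenʰ _ g) e (swap-front _ _)
    in  cutʰ k (height a⊢C) f (with-height a⊢C) ↭-refl

  reduce-∨ (suc k) m (∨r₁ f) r-∨r₁ e₁ _ = cutʰ k m f e₁ ↭-refl
  reduce-∨ (suc k) m (∨r₂ f) r-∨r₂ _ e₂ = cutʰ k m f e₂ ↭-refl

  reduce-n (suc k) (n h q f₁ f₂) r-n b⊢a a⊢b =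
    n h q (exchange (prep _ q) (cutʰ (height b⊢a) k (with-height b⊢a) (weakenʰ _ f₁)
                                     (swap-front _ _ ⟫ prep _ (prep _ (↭-sym q)))))
          (exchange (prep _ q) (cutʰ k (height a⊢b) (exchangeʰ (prep _ (↭-sym q)) f₂)
                                     (weakenʰ _ (with-height a⊢b)) (swap-front _ _)))
  reduce-n _ (nef h q f) r-nef _ _ = nef h q (forget-height f)

  reduce-nef (suc k) h (n _ q f₁ _) r-n ⊢a =
    nef h q (exchange q (cutʰ (height ⊢a) k (with-height ⊢a)
                              (exchangeʰ (prep _ (↭-sym q)) f₁) ↭-refl))
  reduce-nef _ _ (nef h q f) r-nef _ = nef h q (forget-height f)

cut : HasN G → G ⊢ Γ ⇒ A → G ⊢ A ∷ Γ ⇒ C → G ⊢ Γ ⇒ C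
cut hasN d e = CutAdmissibility.cutʰ hasN _ _ (with-height d) (with-height e) ↭-refl

identity : HasN G → ∀ A → G ⊢ A ∷ Γ ⇒ A
identity _ (var p) = ax ↭-refl
identity _ ⊤' = top
identity h (a ∧' b) =
  ∧l ↭-refl (∧r (identity h a) (exchange (swap-front b a) (identity h b)))
identity h (a ∨' b) = ∨l ↭-refl (∨r₁ (identity h a)) (∨r₂ (identity h b))
identity h (a ⇒' b) =
  →r (→l (swap-front a _) (exchange (swap-front a _) (identity h a)) (identity h b))
identity h (¬' a) = n h ↭-refl (identity h a) (identity h a)

∧l₁ : G ⊢ s ∷ Γ ⇒ φ → G ⊢ (s ∧' t) ∷ Γ ⇒ φ
∧l₁ {s = s} {t = t} d = ∧l ↭-refl (weaken-premise [ s ] t d)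

∧l₂ : G ⊢ t ∷ Γ ⇒ φ → G ⊢ (s ∧' t) ∷ Γ ⇒ φ
∧l₂ {s = s} d = ∧l ↭-refl (weaken s d)

-- Interpolation

infix 4 _⊆ᵛ_
_⊆ᵛ_ : Ctx → Ctx → Set
Γ ⊆ᵛ Δ = ∀ {p} → OccursIn p Γ → OccursIn p Δ

keep : ∀ {x} → Γ ⊆ᵛ Δ → x ∷ Γ ⊆ᵛ x ∷ Δ
keep _ (here o) = here o
keep sub (there o) = there (sub o)

absorb₁ : (∀ {p} → Occurs p a → Occurs p c) → a ∷ Γ ⊆ᵛ c ∷ Γ
absorb₁ f (here o) = here (f o)
absorb₁ _ (there o) = there o

absorb₂ : (∀ {p} → Occurs p a → Occurs p c) → (∀ {p} → Occurs p b → Occurs p c) →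
          a ∷ b ∷ Γ ⊆ᵛ c ∷ Γ
absorb₂ f _ (here o) = here (f o)
absorb₂ _ g (there (here o)) = here (g o)
absorb₂ _ _ (there (there o)) = there o

n-premise-vars : a ∷ b ∷ (¬' a) ∷ Δ ⊆ᵛ (¬' b) ∷ (¬' a) ∷ Δ
n-premise-vars (here o) = there (here (o-¬ o))
n-premise-vars (there (here o)) = here (o-¬ o)
n-premise-vars (there (there o)) = there o

CommonLang : Ctx → Ctx → Formula → Set
CommonLang Γ Δ σ = ∀ p → Occurs p σ → InCommon p Γ Δ

common-mono : Γ ⊆ᵛ Γ' → Δ ⊆ᵛ Δ' → CommonLang Γ Δ σ → CommonLang Γ' Δ' σ
common-mono f g L p o with L p o
... | x , y = f x , g y

common-sym : CommonLang Γ Δ σ → CommonLang Δ Γ σ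
common-sym L p o with L p o
... | x , y = y , x

common-∧ : CommonLang Γ Δ s → CommonLang Γ Δ t → CommonLang Γ Δ (s ∧' t)
common-∧ L _ p (o-∧l o) = L p o
common-∧ _ M p (o-∧r o) = M p o

common-∨ : CommonLang Γ Δ s → CommonLang Γ Δ t → CommonLang Γ Δ (s ∨' t)
common-∨ L _ p (o-∨l o) = L p o
common-∨ _ M p (o-∨r o) = M p o

common-⇒ : CommonLang Γ Δ s → CommonLang Γ Δ t → CommonLang Γ Δ (s ⇒' t)
common-⇒ L _ p (o-⇒l o) = L p o
common-⇒ _ M p (o-⇒r o) = M p o

common-¬ : CommonLang Γ Δ s → CommonLang Γ Δ (¬' s)
common-¬ L p (o-¬ o) = L p o

record Interpolant (G : Calculus) (Γ Δ : Ctx) (φ : Formula) : Set where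
  constructor interpolant
  field
    formula : Formula
    vars    : CommonLang Γ (φ ∷ Δ) formula
    left    : G ⊢ Γ ⇒ formula
    right   : G ⊢ formula ∷ Δ ⇒ φ

interpolant-resp-↭ : Γ ↭ Γ' → Δ ↭ Δ' → Interpolant G Γ Δ φ → Interpolant G Γ' Δ' φ
interpolant-resp-↭ {φ = φ} π ρ (interpolant σ L l r) =
  interpolant σ (common-mono (Any-resp-↭ π) (Any-resp-↭ (prep φ ρ)) L)
    (exchange π l) (exchange (prep σ ρ) r)

⊤-interpolant : G ⊢ Δ ⇒ φ → Interpolant G Γ Δ φ
⊤-interpolant d = interpolant ⊤' (λ _ ()) top (weaken ⊤' d)

ax-interpolant : Γ ↭ var p ∷ Γ₀ → Interpolant G Γ Δ (var p)
ax-interpolant ρ =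
  interpolant (var _) (λ { _ o-var → Any-resp-↭ (↭-sym ρ) (here o-var) , here o-var })
    (ax ρ) (ax ↭-refl)

→r-interpolant : Interpolant G Γ (a ∷ Δ) b → Interpolant G Γ Δ (a ⇒' b)
→r-interpolant {a = a} (interpolant σ L l r) =
  interpolant σ (common-mono id (absorb₂ o-⇒r o-⇒l) L) l (→r (exchange (swap-front σ a) r))

∧r-interpolant : Interpolant G Γ Δ a → Interpolant G Γ Δ b → Interpolant G Γ Δ (a ∧' b)
∧r-interpolant (interpolant σ₁ L₁ l₁ r₁) (interpolant σ₂ L₂ l₂ r₂) =
  interpolant (σ₁ ∧' σ₂)
    (common-∧ (common-mono id (absorb₁ o-∧l) L₁) (common-mono id (absorb₁ o-∧r) L₂))
    (∧r l₁ l₂) (∧r (∧l₁ r₁) (∧l₂ r₂))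

∨r₁-interpolant : Interpolant G Γ Δ a → Interpolant G Γ Δ (a ∨' b)
∨r₁-interpolant (interpolant σ L l r) =
  interpolant σ (common-mono id (absorb₁ o-∨l) L) l (∨r₁ r)

∨r₂-interpolant : Interpolant G Γ Δ b → Interpolant G Γ Δ (a ∨' b)
∨r₂-interpolant (interpolant σ L l r) =
  interpolant σ (common-mono id (absorb₁ o-∨r) L) l (∨r₂ r)

an-interpolant : HasAn G → Interpolant G Γ (a ∷ Δ) (¬' a) → Interpolant G Γ Δ (¬' a)
an-interpolant {a = a} h (interpolant σ L l r) =
  interpolant σ (common-mono id (absorb₂ id o-¬) L) l (an h (exchange (swap-front σ a) r))

∧l-interpolantˡ : Interpolant G (a ∷ b ∷ Γ) Δ φ → Interpolant G ((a ∧' b) ∷ Γ) Δ φ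
∧l-interpolantˡ (interpolant σ L l r) =
  interpolant σ (common-mono (absorb₂ o-∧l o-∧r) id L) (∧l ↭-refl l) r

∧l-interpolantʳ : Interpolant G Γ (a ∷ b ∷ Δ) φ → Interpolant G Γ ((a ∧' b) ∷ Δ) φ
∧l-interpolantʳ {a = a} {b = b} (interpolant σ L l r) =
  interpolant σ (common-mono id (keep (absorb₂ o-∧l o-∧r)) L) l
    (∧l (swap-front σ _) (exchange (shifts [ σ ] (a ∷ b ∷ [])) r))

∨l-interpolantˡ : Interpolant G (a ∷ Γ) Δ φ → Interpolant G (b ∷ Γ) Δ φ →
                  Interpolant G ((a ∨' b) ∷ Γ) Δ φ
∨l-interpolantˡ (interpolant σ₁ L₁ l₁ r₁) (interpolant σ₂ L₂ l₂ r₂) =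
  interpolant (σ₁ ∨' σ₂)
    (common-∨ (common-mono (absorb₁ o-∨l) id L₁) (common-mono (absorb₁ o-∨r) id L₂))
    (∨l ↭-refl (∨r₁ l₁) (∨r₂ l₂)) (∨l ↭-refl r₁ r₂)

∨l-interpolantʳ : Interpolant G Γ (a ∷ Δ) φ → Interpolant G Γ (b ∷ Δ) φ →
                  Interpolant G Γ ((a ∨' b) ∷ Δ) φ
∨l-interpolantʳ (interpolant σ₁ L₁ l₁ r₁) (interpolant σ₂ L₂ l₂ r₂) =
  interpolant (σ₁ ∧' σ₂)
    (common-∧ (common-mono id (keep (absorb₁ o-∨l)) L₁)
              (common-mono id (keep (absorb₁ o-∨r)) L₂))
    (∧r l₁ l₂)
    (∨l (swap-front _ _) (exchange (swap-front _ _) (∧l₁ r₁))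
                         (exchange (swap-front _ _) (∧l₂ r₂)))

→l-interpolantˡ : Interpolant G Δ ((a ⇒' b) ∷ Γ) a → Interpolant G (b ∷ Γ) Δ φ →
                  Interpolant G ((a ⇒' b) ∷ Γ) Δ φ
→l-interpolantˡ (interpolant τ L₁ l₁ r₁) (interpolant σ L₂ l₂ r₂) =
  interpolant (τ ⇒' σ)
    (common-⇒ (common-mono (absorb₂ o-⇒l id) there (common-sym L₁))
              (common-mono (absorb₁ o-⇒r) id L₂))
    (→r (→l (swap-front τ _) (exchange (swap-front τ _) r₁)
                             (exchange (swap-front τ _) (weaken τ l₂))))
    (→l ↭-refl (weaken (τ ⇒' σ) l₁) r₂)

→l-interpolantʳ : Interpolant G Γ ((a ⇒' b) ∷ Δ) a → Interpolant G Γ (b ∷ Δ) φ →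
                  Interpolant G Γ ((a ⇒' b) ∷ Δ) φ
→l-interpolantʳ (interpolant τ₁ L₁ l₁ r₁) (interpolant τ₂ L₂ l₂ r₂) =
  interpolant (τ₁ ∧' τ₂)
    (common-∧ (common-mono id (there ∘ absorb₂ o-⇒l id) L₁)
              (common-mono id (keep (absorb₁ o-⇒r)) L₂))
    (∧r l₁ l₂)
    (→l (swap-front _ _) (exchange (swap-front _ _) (∧l₁ r₁))
                         (exchange (swap-front _ _) (∧l₂ r₂)))

-- ¬⊤ acts as a falsum for negated goals: by (nef) it derives every ¬b.
nef-interpolantˡ : HasNeF G → Interpolant G Δ ((¬' a) ∷ Γ) a →
                   Interpolant G ((¬' a) ∷ Γ) Δ (¬' b)
nef-interpolantˡ h (interpolant τ L l r) =
  interpolant (τ ⇒' (¬' ⊤'))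
    (common-⇒ (common-mono (absorb₂ o-¬ id) there (common-sym L)) λ { _ (o-¬ ()) })
    (→r (nef h (swap-front τ _) (exchange (swap-front τ _) r)))
    (→l ↭-refl (weaken _ l) (nef h ↭-refl top))

nef-interpolantʳ : HasNeF G → Interpolant G Γ ((¬' a) ∷ Δ) a →
                   Interpolant G Γ ((¬' a) ∷ Δ) (¬' b)
nef-interpolantʳ h (interpolant σ L l r) =
  interpolant σ (common-mono id (there ∘ absorb₂ o-¬ id) L) l
    (nef h (swap-front σ _) (exchange (swap-front σ _) r))

copc-interpolantˡ : HasCoPC G → Interpolant G (b ∷ Δ) ((¬' a) ∷ Γ) a →
                    Interpolant G ((¬' a) ∷ Γ) Δ (¬' b)
copc-interpolantˡ h (interpolant τ L l r) =
  interpolant (¬' τ) (common-¬ (common-mono (absorb₂ o-¬ id) (absorb₁ o-¬) (common-sym L)))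
    (copc h ↭-refl r) (copc h ↭-refl (exchange (swap-front _ _) (weaken (¬' τ) l)))

copc-interpolantʳ : HasCoPC G → Interpolant G Γ (b ∷ (¬' a) ∷ Δ) a →
                    Interpolant G Γ ((¬' a) ∷ Δ) (¬' b)
copc-interpolantʳ {b = b} {a = a} h (interpolant σ L l r) =
  interpolant σ (common-mono id n-premise-vars L) l
    (copc h (swap-front σ _) (exchange (shifts [ σ ] (b ∷ ¬' a ∷ [])) r))

n-interpolantʳ : HasN G → Interpolant G Γ (b ∷ (¬' a) ∷ Δ) a →
                 Interpolant G Γ (a ∷ (¬' a) ∷ Δ) b → Interpolant G Γ ((¬' a) ∷ Δ) (¬' b)
n-interpolantʳ {b = b} {a = a} h (interpolant τ₁ L₁ l₁ r₁) (interpolant τ₂ L₂ l₂ r₂) =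
  interpolant (τ₁ ∧' τ₂)
    (common-∧ (common-mono id n-premise-vars L₁)
              (common-mono id (n-premise-vars ∘ Any-resp-↭ (swap-front _ _)) L₂))
    (∧r l₁ l₂)
    (n h (swap-front _ _) (exchange (shifts [ _ ] (b ∷ ¬' a ∷ [])) (∧l₁ r₁))
                          (exchange (shifts [ _ ] (a ∷ ¬' a ∷ [])) (∧l₂ r₂)))

-- The premises split the context in opposite ways; ((τ₂ → τ₁) → ¬τ₁) ∧ (τ₁ → τ₂)
-- recombines their interpolants τ₁ and τ₂.
n-interpolantˡ : HasN G → Interpolant G (b ∷ Δ) ((¬' a) ∷ Γ) a →
                 Interpolant G (a ∷ (¬' a) ∷ Γ) Δ b → Interpolant G ((¬' a) ∷ Γ) Δ (¬' b)
n-interpolantˡ {G = G} {b = b} {Δ = Δ} {a = a} {Γ = Γ} h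
               (interpolant τ₁ L₁ l₁ r₁) (interpolant τ₂ L₂ l₂ r₂) =
  interpolant (H ∧' E)
    (common-∧ (common-⇒ (common-⇒ M₂ M₁) (common-¬ M₁)) (common-⇒ M₁ M₂))
    (∧r ⊢H ⊢E) (∧l ↭-refl (→l ↭-refl H,E⊢I ¬τ₁,E⊢¬b))
  where
  I H E : Formula
  I = τ₂ ⇒' τ₁
  H = I ⇒' (¬' τ₁)
  E = τ₁ ⇒' τ₂

  M₁ : CommonLang ((¬' a) ∷ Γ) ((¬' b) ∷ Δ) τ₁
  M₁ = common-mono (absorb₂ o-¬ id) (absorb₁ o-¬) (common-sym L₁)
  M₂ : CommonLang ((¬' a) ∷ Γ) ((¬' b) ∷ Δ) τ₂
  M₂ = common-mono (absorb₂ o-¬ id) (absorb₁ o-¬) L₂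

  ⊢H : G ⊢ (¬' a) ∷ Γ ⇒ H
  ⊢H = →r (n h (swap-front I _) (weaken-premise (τ₁ ∷ ¬' a ∷ []) I r₁)
                (→l (under (a ∷ ¬' a ∷ []) ↭-refl) (weaken I l₂) (identity h τ₁)))
  ⊢E : G ⊢ (¬' a) ∷ Γ ⇒ E
  ⊢E = →r (cut h r₁ (weaken-premise [ a ] τ₁ l₂))

  τ₂⊢τ₁ : G ⊢ τ₂ ∷ Δ ⇒ τ₁
  τ₂⊢τ₁ = cut h r₂ (weaken-premise [ b ] τ₂ l₁)
  H,E⊢I : G ⊢ H ∷ E ∷ Δ ⇒ I
  H,E⊢I = →r (weaken-premise [ τ₂ ] H (weaken-premise [ τ₂ ] E τ₂⊢τ₁))
  ¬τ₁,E⊢¬b : G ⊢ (¬' τ₁) ∷ E ∷ Δ ⇒ ¬' b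
  ¬τ₁,E⊢¬b =
    n h ↭-refl (weaken-premise [ b ] (¬' τ₁) (weaken-premise [ b ] E l₁))
               (→l (under (τ₁ ∷ ¬' τ₁ ∷ []) ↭-refl) (weaken E (identity h τ₁))
                   (weaken-premise [ τ₂ ] τ₁ (weaken-premise [ τ₂ ] (¬' τ₁) r₂)))

interpolate : G ⊢ Π ⇒ φ → ∀ Γ Δ → Π ↭ Γ ++ Δ → Interpolant G Γ Δ φ
interpolate (ax q) Γ Δ π with split Γ Δ (↭-sym π ⟫ q)
... | inˡ ρ _ = ax-interpolant ρ
... | inʳ ρ _ = ⊤-interpolant (ax ρ)
interpolate top Γ Δ π = ⊤-interpolant top
interpolate (→r {a = a} d) Γ Δ π = →r-interpolant (interpolate d Γ _ (extendʳ [ a ] π))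
interpolate (∧r d e) Γ Δ π = ∧r-interpolant (interpolate d Γ Δ π) (interpolate e Γ Δ π)
interpolate (∨r₁ d) Γ Δ π = ∨r₁-interpolant (interpolate d Γ Δ π)
interpolate (∨r₂ d) Γ Δ π = ∨r₂-interpolant (interpolate d Γ Δ π)
interpolate (an h {a = a} d) Γ Δ π = an-interpolant h (interpolate d Γ _ (extendʳ [ a ] π))
interpolate (∧l {a = a} {b} q d) Γ Δ π with split Γ Δ (↭-sym π ⟫ q)
... | inˡ ρ π₀ = interpolant-resp-↭ (↭-sym ρ) ↭-refl
  (∧l-interpolantˡ (interpolate d _ Δ (prep a (prep b π₀))))
... | inʳ ρ π₀ = interpolant-resp-↭ ↭-refl (↭-sym ρ)
  (∧l-interpolantʳ (interpolate d Γ _ (extendʳ (a ∷ b ∷ []) π₀)))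
interpolate (∨l {a = a} {b} q d e) Γ Δ π with split Γ Δ (↭-sym π ⟫ q)
... | inˡ ρ π₀ = interpolant-resp-↭ (↭-sym ρ) ↭-refl
  (∨l-interpolantˡ (interpolate d _ Δ (prep a π₀)) (interpolate e _ Δ (prep b π₀)))
... | inʳ ρ π₀ = interpolant-resp-↭ ↭-refl (↭-sym ρ)
  (∨l-interpolantʳ (interpolate d Γ _ (extendʳ [ a ] π₀)) (interpolate e Γ _ (extendʳ [ b ] π₀)))
interpolate (→l {a = a} {b} q d e) Γ Δ π with split Γ Δ (↭-sym π ⟫ q)
... | inˡ ρ π₀ = interpolant-resp-↭ (↭-sym ρ) ↭-refl
  (→l-interpolantˡ (interpolate d Δ _ (extendˡ-flip [ a ⇒' b ] π₀))
                   (interpolate e _ Δ (prep b π₀)))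
... | inʳ ρ π₀ = interpolant-resp-↭ ↭-refl (↭-sym ρ)
  (→l-interpolantʳ (interpolate d Γ _ (extendʳ [ a ⇒' b ] π₀))
                   (interpolate e Γ _ (extendʳ [ b ] π₀)))
interpolate (n h {a = a} {b = b} q d e) Γ Δ π with split Γ Δ (↭-sym π ⟫ q)
... | inˡ ρ π₀ = interpolant-resp-↭ (↭-sym ρ) ↭-refl
  (n-interpolantˡ h (interpolate d (b ∷ Δ) _ (prep b (extendˡ-flip [ ¬' a ] π₀)))
                    (interpolate e _ Δ (prep a (prep (¬' a) π₀))))
... | inʳ ρ π₀ = interpolant-resp-↭ ↭-refl (↭-sym ρ)
  (n-interpolantʳ h (interpolate d Γ _ (extendʳ (b ∷ ¬' a ∷ []) π₀))
                    (interpolate e Γ _ (extendʳ (a ∷ ¬' a ∷ []) π₀)))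
interpolate (nef h {a = a} q d) Γ Δ π with split Γ Δ (↭-sym π ⟫ q)
... | inˡ ρ π₀ = interpolant-resp-↭ (↭-sym ρ) ↭-refl
  (nef-interpolantˡ h (interpolate d Δ _ (extendˡ-flip [ ¬' a ] π₀)))
... | inʳ ρ π₀ = interpolant-resp-↭ ↭-refl (↭-sym ρ)
  (nef-interpolantʳ h (interpolate d Γ _ (extendʳ [ ¬' a ] π₀)))
interpolate (copc h {a = a} {b = b} q d) Γ Δ π with split Γ Δ (↭-sym π ⟫ q)
... | inˡ ρ π₀ = interpolant-resp-↭ (↭-sym ρ) ↭-refl
  (copc-interpolantˡ h (interpolate d (b ∷ Δ) _ (prep b (extendˡ-flip [ ¬' a ] π₀))))
... | inʳ ρ π₀ = interpolant-resp-↭ ↭-refl (↭-sym ρ)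
  (copc-interpolantʳ h (interpolate d Γ _ (extendʳ (b ∷ ¬' a ∷ []) π₀)))

theorem4p3 : (G : Calculus) (Γ Δ : Ctx) (φ : Formula) →
    ∃ (λ p → InCommon p Γ (φ ∷ Δ)) →
    G ⊢ Γ ++ Δ ⇒ φ →
    Σ Formula (λ σ →
      (∀ p → Occurs p σ → InCommon p Γ (φ ∷ Δ)) ×
      (G ⊢ Γ ⇒ σ) × (G ⊢ σ ∷ Δ ⇒ φ))
theorem4p3 G Γ Δ φ _ d with interpolate d Γ Δ ↭-refl
... | interpolant σ L l r = σ , L , l , r
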